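{- Let $s$ be a store, $h':\mathcal{L}\rightharpoonup\mathcal{L}^{\kappa+\nu+\mu}$ a heap and $h=\mathrm{trunc}(h')$. Let $D_2=\{\ell\in\mathrm{dom}(h')\mid h'(\ell)=\underline{\boldsymbol{\bot}}\}$ and $D_1=\mathrm{dom}(h')\setminus D_2$. Assume that (1) for every $\ell\in D_1$, $h(\ell)$ is of the form $(\ell_1,\dots,\ell_\kappa)$ and $h'(\ell)$ is of the form $(\ell_1,\dots,\ell_\kappa,s(\mathbf{w}),\ell'_1,\dots,\ell'_\mu)$; and (2) every $\ell\in D_2$ has a connection in $h'$, i.e. there is $\ell'\in D_1$ such that $\ell$ is among the last $\mu$ components of $h'(\ell')$. Then $(s,h')\triangleright_{\mathrm{id}}(s,h)$.
   Context: Fix natural numbers $\kappa$, $\mu$, and $\nu>0$, and a vector $\mathbf{w}=(w_1,\dots,w_\nu)$ of variables; $s(\mathbf{w})=(s(w_1),\dots,s(w_\nu))$. Locations form a countably infinite set $\mathcal{L}$ containing $\underline{\bot}$; stores $s$ are partial maps from variables and a constant $\bot$ to $\mathcal{L}$ with $s(x)=\underline{\bot}$ iff $x=\bot$, and $\{w_1,\dots,w_\nu,\bot\}\subseteq\mathrm{dom}(s)$. Heaps are finite partial maps from $\mathcal{L}$ to tuples of locations, not allocating $\underline{\bot}$. $\underline{\boldsymbol{\bot}}$ is the $(\kappa+\nu+\mu)$-tuple of $\underline{\bot}$. Truncation: $\mathrm{trunc}(h')$ has domain $\mathrm{dom}(h')\setminus\{\ell\mid h'(\ell)=\underline{\boldsymbol{\bot}}\}$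 and maps $\ell$ to the first $\kappa$ components of $h'(\ell)$. Expansion: for total $\gamma:\mathcal{L}\to\mathcal{L}$, $h:\mathcal{L}\rightharpoonup\mathcal{L}^\kappa$, $h':\mathcal{L}\rightharpoonup\mathcal{L}^{\kappa+\nu+\mu}$, $(s,h')\triangleright_\gamma(s,h)$ iff $h'=\mathrm{main}(h')\uplus\mathrm{aux}(h')$ for disjoint heaps such that: (1) $\gamma$ is injective on $\mathrm{dom}(\mathrm{main}(h'))$; (2) $\gamma(\mathrm{dom}(\mathrm{main}(h')))=\mathrm{dom}(h)$; (3) for every $\ell\in\mathrm{dom}(\mathrm{main}(h'))$, $h'(\ell)=(\mathbf{a},s(\mathbf{w}),b_1,\dots,b_\mu)$ with $\gamma(\mathbf{a})=h(\gamma(\ell))$ (componentwise); (4) for every $\ell\in\mathrm{dom}(\mathrm{aux}(h'))$, $h'(\ell)=\underline{\boldsymbol{\bot}}$ and $\ell$ occurs among the last $\mu$ components of $\mathrm{main}(h')(\ell')$ for some $\ell'\in\mathrm{dom}(\mathrm{main}(h'))$. $\mathrm{id}$ is the identity on $\mathcal{L}$. -}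

module Defs where

open import Data.Nat using (ℕ; zero; suc; _+_; _≟_)
open import Data.Maybe using (Maybe; just; nothing)
open import Data.Vec using (Vec; _++_; replicate; take; lookup)
open import Data.Vec.Properties using (≡-dec)
open import Data.Vec.Membership.Propositional using () renaming (_∈_ to _∈ᵥ_)
open import Data.List using (List)
open import Data.List.Membership.Propositional using (_∈_)
open import Data.Fin using (Fin)
open import Data.Product using (Σ; ∃; ∃-syntax; _×_; _,_)
open import Data.Sum using (_⊎_)
open import Relation.Nullary using (¬_; yes; no)
open import Relation.Binary.PropositionalEquality using (_≡_; _≢_)
open import Function using (id)

-- Locations: a countably infinite set; we take ℕ, with ⊥̲ = 0.
Loc : Set
Loc = ℕ

⊥L : Loc
⊥L = 0

-- Variables (countably many); terms are variables or the constant ⊥ (= nothing).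
Var : Set
Var = ℕ

Term : Set
Term = Maybe Var

record Store {ν : ℕ} (w : Vec Var ν) : Set where
  field
    val      : Term → Maybe Loc
    val-bot  : val nothing ≡ just ⊥L
    val-var  : ∀ x l → val (just x) ≡ just l → l ≢ ⊥L
    sw       : Vec Loc ν
    val-w    : ∀ (i : Fin ν) → val (just (lookup w i)) ≡ just (lookup sw i)
open Store public

PMap : ℕ → Set
PMap n = Loc → Maybe (Vec Loc n)

record Heap (n : ℕ) : Set where
  field
    fun    : PMap n
    finite : ∃[ xs ] (∀ l v → fun l ≡ just v → l ∈ xs)
    no-bot : fun ⊥L ≡ nothing
open Heap public

⊥tuple : (n : ℕ) → Vec Loc n
⊥tuple n = replicate n ⊥L

_∈dom_ : ∀ {n} → Loc → PMap n → Set
l ∈dom h = ∃[ v ] (h l ≡ just v)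

trunc : ∀ κ ν μ → PMap (κ + ν + μ) → PMap κ
trunc κ ν μ h' l with h' l
... | nothing = nothing
... | just v with ≡-dec _≟_ v (⊥tuple (κ + ν + μ))
...   | yes _ = nothing
...   | no  _ = just (take κ (take (κ + ν) v))

InLast : ∀ κ ν μ → Loc → Vec Loc (κ + ν + μ) → Set
InLast κ ν μ l v = Σ (Vec Loc (κ + ν)) λ a → Σ (Vec Loc μ) λ b → (v ≡ a ++ b × l ∈ᵥ b)

Expansion : ∀ κ ν μ {w : Vec Var ν} → Store w → PMap (κ + ν + μ)
          → (Loc → Loc) → PMap κ → Set
Expansion κ ν μ s h' γ h =
  Σ (PMap (κ + ν + μ)) λ main → Σ (PMap (κ + ν + μ)) λ aux →
    -- h' = main ⊎ aux (disjoint union)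
    (∀ l → (h' l ≡ main l × aux l ≡ nothing) ⊎ (h' l ≡ aux l × main l ≡ nothing))
  × (∀ l l' → l ∈dom main → l' ∈dom main → γ l ≡ γ l' → l ≡ l')
  × (∀ l → l ∈dom main → γ l ∈dom h)
  × (∀ l → l ∈dom h → ∃[ l' ] (l' ∈dom main × γ l' ≡ l))
    -- (3)
  × (∀ l v → main l ≡ just v →
       Σ (Vec Loc κ) λ a → Σ (Vec Loc μ) λ b → (v ≡ (a ++ sw s) ++ b × h (γ l) ≡ just (Data.Vec.map γ a)))
    -- (4)
  × (∀ l v → aux l ≡ just v →
       v ≡ ⊥tuple (κ + ν + μ)
       × ∃[ l' ] ∃[ v' ] (main l' ≡ just v' × InLast κ ν μ l v'))

-- The expansion is witnessed by γ = id and the split of h' into the cells holding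
-- a proper tuple (main) and those holding the ⊥-tuple (aux).  Truncation drops
-- exactly the aux cells, so dom(main) = dom(trunc h'); hypothesis (1) then gives
-- condition (3) and hypothesis (2) gives condition (4).
module Submission where

open import Defs
open import Level using (Level)
open import Data.Nat using (ℕ; _+_; _>_; _≟_)
open import Data.Maybe using (Maybe; just; nothing)
open import Data.Vec using (Vec; _++_)
open import Data.Vec.Properties using (≡-dec; map-id)
open import Data.Product using (Σ; ∃-syntax; _×_; _,_)
open import Data.Sum using (_⊎_; inj₁; inj₂)
open import Relation.Nullary using (yes; no; contradiction)
open import Relation.Unary using (Pred; Decidable)
open import Relation.Unary.Properties using (∁?)
open import Relation.Binary.PropositionalEquality using (_≡_; _≢_; refl; trans; cong; sym)
open import Function using (id)

module _ {a p : Level} {A : Set a} where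

  filterᴹ : {P : Pred A p} → Decidable P → Maybe A → Maybe A
  filterᴹ P? nothing = nothing
  filterᴹ P? (just x) with P? x
  ... | yes _ = just x
  ... | no  _ = nothing

  filterᴹ-just⁺ : {P : Pred A p} (P? : Decidable P) → ∀ {x} → P x → filterᴹ P? (just x) ≡ just x
  filterᴹ-just⁺ P? {x} px with P? x
  ... | yes _  = refl
  ... | no ¬px = contradiction px ¬px

  filterᴹ-just⁻ : {P : Pred A p} (P? : Decidable P) → ∀ m {x} → filterᴹ P? m ≡ just x → m ≡ just x × P x
  filterᴹ-just⁻ P? (just y) eq with P? y
  filterᴹ-just⁻ P? (just y) refl | yes py = refl , py

  filterᴹ-∁-partition : {P : Pred A p} (P? : Decidable P) → ∀ m →
    (m ≡ filterᴹ (∁? P?) m × filterᴹ P? m ≡ nothing) ⊎ (m ≡ filterᴹ P? m × filterᴹ (∁? P?) m ≡ nothing)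
  filterᴹ-∁-partition P? nothing = inj₁ (refl , refl)
  filterᴹ-∁-partition P? (just x) with P? x
  ... | yes _ = inj₂ (refl , refl)
  ... | no  _ = inj₁ (refl , refl)

≟-⊥tuple : ∀ {n} → Decidable (_≡ ⊥tuple n)
≟-⊥tuple v = ≡-dec _≟_ v (⊥tuple _)

module _ (κ ν μ : ℕ) (h' : PMap (κ + ν + μ)) where

  mainPart auxPart : PMap (κ + ν + μ)
  mainPart l = filterᴹ (∁? ≟-⊥tuple) (h' l)
  auxPart  l = filterᴹ ≟-⊥tuple (h' l)

  dom-trunc⊆dom-mainPart : ∀ l → l ∈dom trunc κ ν μ h' → l ∈dom mainPart
  dom-trunc⊆dom-mainPart l (t , eq) with h' l
  ... | just v with ≟-⊥tuple v
  ...   | no _ = v , refl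

lemma4 : (κ μ ν : ℕ) → ν > 0 → (w : Vec Var ν) → (s : Store w) → (h' : Heap (κ + ν + μ))
    → (∀ l v → fun h' l ≡ just v → v ≢ ⊥tuple (κ + ν + μ)
        → Σ (Vec Loc κ) λ a → Σ (Vec Loc μ) λ b → (trunc κ ν μ (fun h') l ≡ just a × v ≡ (a ++ sw s) ++ b))
    → (∀ l → fun h' l ≡ just (⊥tuple (κ + ν + μ))
        → ∃[ l' ] ∃[ v' ] (fun h' l' ≡ just v' × v' ≢ ⊥tuple (κ + ν + μ) × InLast κ ν μ l v'))
    → Expansion κ ν μ s (fun h') id (trunc κ ν μ (fun h'))
lemma4 κ μ ν _ _ s h' proper connected =
    mainPart κ ν μ (fun h') , auxPart κ ν μ (fun h')
  , (λ l → filterᴹ-∁-partition ≟-⊥tuple (fun h' l))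
  , (λ _ _ _ _ eq → eq)
  , main⊆trunc
  , (λ l l∈ → l , dom-trunc⊆dom-mainPart κ ν μ (fun h') l l∈ , refl)
  , main-shape
  , aux-connected
  where
  inMain : ∀ {l v} → fun h' l ≡ just v → v ≢ ⊥tuple (κ + ν + μ) → mainPart κ ν μ (fun h') l ≡ just v
  inMain eq v≢⊥ = trans (cong (filterᴹ (∁? ≟-⊥tuple)) eq) (filterᴹ-just⁺ (∁? ≟-⊥tuple) v≢⊥)

  main-shape : ∀ l v → mainPart κ ν μ (fun h') l ≡ just v →
    Σ (Vec Loc κ) λ a → Σ (Vec Loc μ) λ b →
      (v ≡ (a ++ sw s) ++ b × trunc κ ν μ (fun h') l ≡ just (Data.Vec.map id a))
  main-shape l v eq with filterᴹ-just⁻ (∁? ≟-⊥tuple) (fun h' l) eq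
  ... | h'l≡v , v≢⊥ with proper l v h'l≡v v≢⊥
  ...   | a , b , trunc≡a , v≡ab = a , b , v≡ab , trans trunc≡a (cong just (sym (map-id a)))

  main⊆trunc : ∀ l → l ∈dom mainPart κ ν μ (fun h') → l ∈dom trunc κ ν μ (fun h')
  main⊆trunc l (v , eq) with main-shape l v eq
  ... | a , _ , _ , trunc≡a = _ , trunc≡a

  aux-connected : ∀ l v → auxPart κ ν μ (fun h') l ≡ just v →
    v ≡ ⊥tuple (κ + ν + μ) × ∃[ l' ] ∃[ v' ] (mainPart κ ν μ (fun h') l' ≡ just v' × InLast κ ν μ l v')
  aux-connected l v eq with filterᴹ-just⁻ ≟-⊥tuple (fun h' l) eq
  ... | h'l≡v , refl with connected l h'l≡v
  ...   | l' , v' , h'l'≡v' , v'≢⊥ , inLast = refl , l' , v' , inMain h'l'≡v' v'≢⊥ , inLast
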